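{- Let $p\ge 1$ and $s\ge 1$ be integers and let $(\mathbf{d},\mathbf{r})$ be an arithmetical structure on the coconut tree $\mathcal{CT}(p,s)$. Then $(\mathbf{d},\mathbf{r})$ is smooth if and only if $r_{\ell_j}<r_p$ for all $1\le j\le s$ and $r_1<r_2<\cdots<r_p$.
   Context: The coconut tree $\mathcal{CT}(p,s)$ is the graph with vertices $v_1,\dots,v_p,v_{\ell_1},\dots,v_{\ell_s}$ and edges $v_iv_{i+1}$ for $1\le i\le p-1$ and $v_pv_{\ell_j}$ for $1\le j\le s$ (a path on $p$ vertices with $s$ leaves attached to $v_p$). An arithmetical structure on a finite connected simple graph $G$ is a pair $(\mathbf{d},\mathbf{r})$ of vectors of positive integers indexed by the vertices with $(\operatorname{diag}(\mathbf{d})-A)\mathbf{r}=\mathbf{0}$, $A$ the adjacency matrix of $G$, and such that the entries of $\mathbf{r}$ have greatest common divisor $1$; equivalently, for every vertex $v$, $d_v r_v$ equals the sum of $r_u$ over the neighbors $u$ of $v$. On $\mathcal{CT}(p,s)$ we write $\mathbf{r}=(r_1,\dots,r_p,r_{\ell_1},\dots,r_{\ell_s})$ and $\mathbf{d}=(d_1,\dots,d_p,d_{\ell_1},\dots,d_{\ell_s})$. An arithmetical structure on $\mathcal{CT}(p,s)$ is smooth if $d_1,\dots,d_{p-1},d_{\ell_1},\dots,d_{\ell_s}\ge 2$ (no condition on $d_p$). -}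

module Defs where

open import Data.Nat using (ℕ; zero; suc; _+_; _*_; _≤_; _<_; _≟_)
open import Data.Nat.GCD using (gcd)
open import Data.Fin using (Fin; toℕ)
open import Data.Sum using (_⊎_; inj₁; inj₂)
open import Data.Product using (_×_)
open import Relation.Binary.PropositionalEquality using (_≡_)
open import Relation.Nullary.Decidable using (⌊_⌋)
open import Data.Bool using (Bool; true; false; if_then_else_; _∨_)

sumFin : (n : ℕ) → (Fin n → ℕ) → ℕ
sumFin zero    f = 0
sumFin (suc n) f = f Fin.zero + sumFin n (λ i → f (Fin.suc i))

gcdFin : (n : ℕ) → (Fin n → ℕ) → ℕ
gcdFin zero    f = 0
gcdFin (suc n) f = gcd (f Fin.zero) (gcdFin n (λ i → f (Fin.suc i)))

-- Vertices of the coconut tree CT(p,s):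
--   inj₁ i  (i : Fin p)  is the path vertex v_{toℕ i + 1}
--   inj₂ j  (j : Fin s)  is the leaf v_{ℓ_{toℕ j + 1}}
CTVertex : ℕ → ℕ → Set
CTVertex p s = Fin p ⊎ Fin s

ctAdj : (p s : ℕ) → CTVertex p s → CTVertex p s → Bool
ctAdj p s (inj₁ i) (inj₁ j) = ⌊ toℕ j ≟ suc (toℕ i) ⌋ ∨ ⌊ toℕ i ≟ suc (toℕ j) ⌋
ctAdj p s (inj₁ i) (inj₂ l) = ⌊ suc (toℕ i) ≟ p ⌋
ctAdj p s (inj₂ l) (inj₁ i) = ⌊ suc (toℕ i) ≟ p ⌋
ctAdj p s (inj₂ l) (inj₂ m) = false

ctA : (p s : ℕ) → CTVertex p s → CTVertex p s → ℕ
ctA p s v u = if ctAdj p s v u then 1 else 0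

sumV : (p s : ℕ) → (CTVertex p s → ℕ) → ℕ
sumV p s f = sumFin p (λ i → f (inj₁ i)) + sumFin s (λ j → f (inj₂ j))

gcdV : (p s : ℕ) → (CTVertex p s → ℕ) → ℕ
gcdV p s f = gcd (gcdFin p (λ i → f (inj₁ i))) (gcdFin s (λ j → f (inj₂ j)))

record IsArithStructure (p s : ℕ) (d r : CTVertex p s → ℕ) : Set where
  field
    d-pos : ∀ v → 1 ≤ d v
    r-pos : ∀ v → 1 ≤ r v
    balance : ∀ v → d v * r v ≡ sumV p s (λ u → ctA p s v u * r u)
    r-gcd : gcdV p s r ≡ 1

-- Smooth: d_1,…,d_{p-1} ≥ 2 and d_{ℓ_j} ≥ 2 for all j (no condition on d_p).
IsSmooth : (p s : ℕ) → (d : CTVertex p s → ℕ) → Set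
IsSmooth p s d =
  (∀ (i : Fin p) → suc (toℕ i) < p → 2 ≤ d (inj₁ i)) ×
  (∀ (j : Fin s) → 2 ≤ d (inj₂ j))

{-# OPTIONS --safe #-}
module Submission where

-- Every vertex v ≠ v_p has at most two neighbours, so its balance equation has the form
-- d_v r_v = a + b: d_ℓ r_ℓ = 0 + r_p at a leaf, and d_i r_i = r_{i-1} + r_{i+1} at v_i for
-- i < p, with r_0 := 0. When a < r_v, such an equation makes d_v ≥ 2 equivalent to r_v < b.
-- At a leaf a < r_v is positivity; on the path r_{i-1} < r_i comes from the increasing
-- hypothesis in one direction and from induction along the path (starting at r_0 < r_1) in
-- the other.

open import Defs
open import Data.Bool using (true; false; _∨_; if_then_else_)
open import Data.Bool.Properties using (∨-zeroʳ)
open import Data.Empty using (⊥-elim)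
open import Data.Fin using (Fin; zero; suc; toℕ; inject₁; fromℕ; fromℕ<)
open import Data.Fin.Induction using (<-weakInduction)
open import Data.Fin.Properties using (toℕ-injective; toℕ-inject₁; toℕ-fromℕ; toℕ-fromℕ<; toℕ<n)
  renaming (suc-injective to Fin-suc-injective)
open import Data.Nat using (ℕ; suc; _+_; _*_; _≤_; _<_; _≟_)
open import Data.Nat.Properties
open import Data.Product using (_×_; _,_)
open import Data.Sum using (inj₁; inj₂)
open import Function using (_∘_)
open import Function.Bundles using (_⇔_; mk⇔; Equivalence)
open import Relation.Binary.PropositionalEquality
open import Relation.Nullary using (¬_; Dec)
open import Relation.Nullary.Decidable using (⌊_⌋; isYes≗does; dec-true; dec-false)

sumFin-zeros : ∀ n (f : Fin n → ℕ) → (∀ u → f u ≡ 0) → sumFin n f ≡ 0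
sumFin-zeros 0       f f≡0 = refl
sumFin-zeros (suc n) f f≡0 = cong₂ _+_ (f≡0 zero) (sumFin-zeros n (f ∘ suc) (f≡0 ∘ suc))

sumFin-single : ∀ n (f : Fin n → ℕ) k → (∀ u → u ≢ k → f u ≡ 0) → sumFin n f ≡ f k
sumFin-single (suc n) f zero    off =
  trans (cong (f zero +_) (sumFin-zeros n (f ∘ suc) (λ u → off (suc u) λ ()))) (+-identityʳ _)
sumFin-single (suc n) f (suc k) off =
  cong₂ _+_ (off zero λ ()) (sumFin-single n (f ∘ suc) k (λ u u≢k → off (suc u) (u≢k ∘ Fin-suc-injective)))

sumFin-pair : ∀ n (f : Fin n → ℕ) k₁ k₂ → k₁ ≢ k₂ →
              (∀ u → u ≢ k₁ → u ≢ k₂ → f u ≡ 0) → sumFin n f ≡ f k₁ + f k₂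
sumFin-pair (suc n) f zero     zero     k₁≢k₂ off = ⊥-elim (k₁≢k₂ refl)
sumFin-pair (suc n) f zero     (suc k₂) k₁≢k₂ off =
  cong (f zero +_) (sumFin-single n (f ∘ suc) k₂ (λ u u≢k₂ → off (suc u) (λ ()) (u≢k₂ ∘ Fin-suc-injective)))
sumFin-pair (suc n) f (suc k₁) zero     k₁≢k₂ off =
  trans (cong (f zero +_) (sumFin-single n (f ∘ suc) k₁ (λ u u≢k₁ → off (suc u) (u≢k₁ ∘ Fin-suc-injective) (λ ()))))
        (+-comm (f zero) _)
sumFin-pair (suc n) f (suc k₁) (suc k₂) k₁≢k₂ off =
  cong₂ _+_ (off zero (λ ()) (λ ()))
            (sumFin-pair n (f ∘ suc) k₁ k₂ (k₁≢k₂ ∘ cong suc)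
              (λ u u≢k₁ u≢k₂ → off (suc u) (u≢k₁ ∘ Fin-suc-injective) (u≢k₂ ∘ Fin-suc-injective)))

d*x≡a+b⇒2≤d⇔x<b : ∀ {d x a b} → d * x ≡ a + b → a < x → 2 ≤ d ⇔ x < b
d*x≡a+b⇒2≤d⇔x<b {d} {x} {a} {b} d*x≡a+b a<x = mk⇔ to from
  where
  open ≤-Reasoning
  to : 2 ≤ d → x < b
  to 2≤d = +-cancelˡ-< x x b (begin-strict
    x + x   ≡⟨ cong (x +_) (sym (+-identityʳ x)) ⟩
    2 * x   ≤⟨ *-monoˡ-≤ x 2≤d ⟩
    d * x   ≡⟨ d*x≡a+b ⟩
    a + b   <⟨ +-monoˡ-< b a<x ⟩
    x + b   ∎)
  from : x < b → 2 ≤ d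
  from x<b = *-cancelʳ-< x 1 d (begin-strict
    1 * x   ≡⟨ *-identityˡ x ⟩
    x       <⟨ x<b ⟩
    b       ≤⟨ m≤n+m b a ⟩
    a + b   ≡⟨ d*x≡a+b ⟨
    d * x   ∎)

⌊⌋-true : ∀ {A : Set} (a? : Dec A) → A → ⌊ a? ⌋ ≡ true
⌊⌋-true a? a = trans (isYes≗does a?) (dec-true a? a)

⌊⌋-false : ∀ {A : Set} (a? : Dec A) → ¬ A → ⌊ a? ⌋ ≡ false
⌊⌋-false a? ¬a = trans (isYes≗does a?) (dec-false a? ¬a)

prev : ∀ {n} → (Fin n → ℕ) → Fin n → ℕ
prev f zero    = 0
prev f (suc i) = f (inject₁ i)

Consecutive : ∀ {n} → Fin n → Fin n → Set
Consecutive i k = toℕ k ≡ suc (toℕ i)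

consecutive-inject₁ : ∀ {n} (i : Fin n) → Consecutive (inject₁ i) (suc i)
consecutive-inject₁ i = cong suc (sym (toℕ-inject₁ i))

consecutive⇒suc< : ∀ {n} {i k : Fin n} → Consecutive i k → suc (toℕ i) < n
consecutive⇒suc< {n} {k = k} c = subst (_< n) c (toℕ<n k)

consecutive-injectiveʳ : ∀ {n} {i k u : Fin n} → Consecutive i k → Consecutive i u → u ≡ k
consecutive-injectiveʳ c c′ = toℕ-injective (trans c′ (sym c))

consecutive-injectiveˡ : ∀ {n} {h i u : Fin n} → Consecutive h i → Consecutive u i → u ≡ h
consecutive-injectiveˡ c c′ = toℕ-injective (suc-injective (trans (sym c′) c))

module _ {p s : ℕ} where

  ctA-successor : ∀ {i u} → Consecutive i u → ctA p s (inj₁ i) (inj₁ u) ≡ 1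
  ctA-successor {i} {u} c =
    cong (λ b → if b ∨ ⌊ toℕ i ≟ suc (toℕ u) ⌋ then 1 else 0) (⌊⌋-true (toℕ u ≟ suc (toℕ i)) c)

  ctA-predecessor : ∀ {i u} → Consecutive u i → ctA p s (inj₁ i) (inj₁ u) ≡ 1
  ctA-predecessor {i} {u} c = cong (λ b → if b then 1 else 0)
    (trans (cong (⌊ toℕ u ≟ suc (toℕ i) ⌋ ∨_) (⌊⌋-true (toℕ i ≟ suc (toℕ u)) c)) (∨-zeroʳ _))

  ctA-path-far : ∀ {i u} → ¬ Consecutive i u → ¬ Consecutive u i → ctA p s (inj₁ i) (inj₁ u) ≡ 0
  ctA-path-far {i} {u} ¬iu ¬ui = cong₂ (λ b b′ → if b ∨ b′ then 1 else 0)
    (⌊⌋-false (toℕ u ≟ suc (toℕ i)) ¬iu) (⌊⌋-false (toℕ i ≟ suc (toℕ u)) ¬ui)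

  ctA-path-leaf : ∀ {i} l → suc (toℕ i) ≢ p → ctA p s (inj₁ i) (inj₂ l) ≡ 0
  ctA-path-leaf {i} l ¬last = cong (λ b → if b then 1 else 0) (⌊⌋-false (suc (toℕ i) ≟ p) ¬last)

  ctA-leaf-last : ∀ l {i} → suc (toℕ i) ≡ p → ctA p s (inj₂ l) (inj₁ i) ≡ 1
  ctA-leaf-last l {i} last = cong (λ b → if b then 1 else 0) (⌊⌋-true (suc (toℕ i) ≟ p) last)

  ctA-leaf-path : ∀ l {i} → suc (toℕ i) ≢ p → ctA p s (inj₂ l) (inj₁ i) ≡ 0
  ctA-leaf-path l {i} ¬last = cong (λ b → if b then 1 else 0) (⌊⌋-false (suc (toℕ i) ≟ p) ¬last)

  neighbourSum : (CTVertex p s → ℕ) → CTVertex p s → ℕ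
  neighbourSum f v = sumV p s (λ u → ctA p s v u * f u)

  leaf-neighbourSum : ∀ f l t → suc (toℕ t) ≡ p → neighbourSum f (inj₂ l) ≡ f (inj₁ t)
  leaf-neighbourSum f l t last = begin
    neighbourSum f (inj₂ l)
      ≡⟨ cong₂ _+_ (sumFin-single p _ t other) (sumFin-zeros s _ (λ _ → refl)) ⟩
    ctA p s (inj₂ l) (inj₁ t) * f (inj₁ t) + 0
      ≡⟨ +-identityʳ _ ⟩
    ctA p s (inj₂ l) (inj₁ t) * f (inj₁ t)
      ≡⟨ cong (_* f (inj₁ t)) (ctA-leaf-last l last) ⟩
    1 * f (inj₁ t)
      ≡⟨ *-identityˡ _ ⟩
    f (inj₁ t) ∎
    where
    open ≡-Reasoning
    other : ∀ u → u ≢ t → ctA p s (inj₂ l) (inj₁ u) * f (inj₁ u) ≡ 0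
    other u u≢t = cong (_* f (inj₁ u)) (ctA-leaf-path l (λ e → u≢t (toℕ-injective (suc-injective (trans e (sym last))))))

  neighbourSum-path-part : ∀ (g : Fin p → ℕ) i k → Consecutive i k →
                           sumFin p (λ u → ctA p s (inj₁ i) (inj₁ u) * g u) ≡ prev g i + g k
  neighbourSum-path-part g zero k c =
    trans (sumFin-single p _ k other) (trans (cong (_* g k) (ctA-successor c)) (*-identityˡ _))
    where
    other : ∀ u → u ≢ k → ctA p s (inj₁ zero) (inj₁ u) * g u ≡ 0
    other u u≢k = cong (_* g u) (ctA-path-far (u≢k ∘ consecutive-injectiveʳ c) λ ())
  neighbourSum-path-part g (suc h) k c =
    trans (sumFin-pair p _ (inject₁ h) k h≢k other)
          (cong₂ _+_ (weight (ctA-predecessor (consecutive-inject₁ h))) (weight (ctA-successor c)))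
    where
    weight : ∀ {u} → ctA p s (inj₁ (suc h)) (inj₁ u) ≡ 1 → ctA p s (inj₁ (suc h)) (inj₁ u) * g u ≡ g u
    weight {u} a≡1 = trans (cong (_* g u) a≡1) (*-identityˡ _)
    h≢k : inject₁ h ≢ k
    h≢k e = <-irrefl (trans (sym (toℕ-inject₁ h)) (trans (cong toℕ e) c)) (m<n⇒m<1+n (n<1+n _))
    other : ∀ u → u ≢ inject₁ h → u ≢ k → ctA p s (inj₁ (suc h)) (inj₁ u) * g u ≡ 0
    other u u≢h u≢k = cong (_* g u) (ctA-path-far (u≢k ∘ consecutive-injectiveʳ c)
                                                  (u≢h ∘ consecutive-injectiveˡ (consecutive-inject₁ h)))

  path-neighbourSum : ∀ f i k → Consecutive i k → neighbourSum f (inj₁ i) ≡ prev (f ∘ inj₁) i + f (inj₁ k)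
  path-neighbourSum f i k c =
    trans (cong₂ _+_ (neighbourSum-path-part (f ∘ inj₁) i k c) (sumFin-zeros s _ no-leaf)) (+-identityʳ _)
    where
    no-leaf : ∀ l → ctA p s (inj₁ i) (inj₂ l) * f (inj₂ l) ≡ 0
    no-leaf l = cong (_* f (inj₂ l)) (ctA-path-leaf l (λ e → <-irrefl (trans c e) (toℕ<n k)))

module _ {n s : ℕ} {d r : CTVertex (suc n) s → ℕ} (A : IsArithStructure (suc n) s d r) where
  open IsArithStructure A
  open Equivalence

  leaf-smooth⇔< : ∀ l t → suc (toℕ t) ≡ suc n → 2 ≤ d (inj₂ l) ⇔ r (inj₂ l) < r (inj₁ t)
  leaf-smooth⇔< l t last =
    d*x≡a+b⇒2≤d⇔x<b {a = 0} (trans (balance (inj₂ l)) (leaf-neighbourSum r l t last)) (r-pos (inj₂ l))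

  path-vertex-smooth⇔< : ∀ i k → Consecutive i k → prev (r ∘ inj₁) i < r (inj₁ i) →
                          2 ≤ d (inj₁ i) ⇔ r (inj₁ i) < r (inj₁ k)
  path-vertex-smooth⇔< i k c = d*x≡a+b⇒2≤d⇔x<b (trans (balance (inj₁ i)) (path-neighbourSum r i k c))

  leaves-smooth⇔ : (∀ l → 2 ≤ d (inj₂ l)) ⇔ (∀ l t → suc (toℕ t) ≡ suc n → r (inj₂ l) < r (inj₁ t))
  leaves-smooth⇔ = mk⇔
    (λ smooth l t last → to (leaf-smooth⇔< l t last) (smooth l))
    (λ below l → from (leaf-smooth⇔< l (fromℕ n) last) (below l (fromℕ n) last))
    where last = cong suc (toℕ-fromℕ n)

  PathSmooth PathIncreasing : Set
  PathSmooth = ∀ i → suc (toℕ i) < suc n → 2 ≤ d (inj₁ i)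
  PathIncreasing = ∀ i k → Consecutive i k → r (inj₁ i) < r (inj₁ k)

  prev<-of-increasing : PathIncreasing → ∀ i → prev (r ∘ inj₁) i < r (inj₁ i)
  prev<-of-increasing increasing zero    = r-pos (inj₁ zero)
  prev<-of-increasing increasing (suc j) = increasing (inject₁ j) (suc j) (consecutive-inject₁ j)

  prev<-of-smooth : PathSmooth → ∀ i → prev (r ∘ inj₁) i < r (inj₁ i)
  prev<-of-smooth smooth = <-weakInduction (λ i → prev (r ∘ inj₁) i < r (inj₁ i)) (r-pos (inj₁ zero)) step
    where
    step : ∀ j → prev (r ∘ inj₁) (inject₁ j) < r (inj₁ (inject₁ j)) → r (inj₁ (inject₁ j)) < r (inj₁ (suc j))
    step j ih = to (path-vertex-smooth⇔< (inject₁ j) (suc j) c ih) (smooth (inject₁ j) (consecutive⇒suc< c))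
      where c = consecutive-inject₁ j

  path-smooth⇔ : PathSmooth ⇔ PathIncreasing
  path-smooth⇔ = mk⇔
    (λ smooth i k c → to (path-vertex-smooth⇔< i k c (prev<-of-smooth smooth i)) (smooth i (consecutive⇒suc< c)))
    (λ increasing i i<n → let k = fromℕ< i<n; c = toℕ-fromℕ< i<n in
      from (path-vertex-smooth⇔< i k c (prev<-of-increasing increasing i)) (increasing i k c))

lemma2p5 : (p s : ℕ) → 1 ≤ p → 1 ≤ s →
           (d r : CTVertex p s → ℕ) → IsArithStructure p s d r →
           IsSmooth p s d ⇔
             ((∀ (j : Fin s) (i : Fin p) → suc (toℕ i) ≡ p → r (inj₂ j) < r (inj₁ i)) ×
              (∀ (i k : Fin p) → toℕ k ≡ suc (toℕ i) → r (inj₁ i) < r (inj₁ k)))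
lemma2p5 0       s () _ d r A
lemma2p5 (suc n) s _  _ d r A = mk⇔
  (λ (path , leaves) → to (leaves-smooth⇔ A) leaves , to (path-smooth⇔ A) path)
  (λ (leaves , path) → from (path-smooth⇔ A) path , from (leaves-smooth⇔ A) leaves)
  where open Equivalence
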